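{- Let $\ell$ be an integer and let $G$ be a connected loopless multigraph on $n$ vertices with $\mu(G)\le n-1+\ell$. Then the total multiplicity of the multi-edges of $G$ is at most $2\ell^2$.
   Context: For a multigraph $G$ with vertex set $V$, the size of a cut $A\subseteq V$ is the number of edges (counted with multiplicity) with exactly one endpoint in $A$, and $\mu(G)$ is the maximum size of a cut. A multi-edge is a pair of vertices joined by $m\ge 2$ parallel edges; the total multiplicity of the multi-edges is the sum of $m$ over all such pairs. -}

module Defs where

open import Data.Nat using (ℕ; zero; suc; _+_; _<_; _≤_; _⊔_; _<ᵇ_; _≤ᵇ_)
open import Data.Fin using (Fin; zero; suc; toℕ)
open import Data.Bool using (Bool; true; false; if_then_else_; _xor_)
open import Data.List using (List; []; _∷_; map; concatMap; foldr)
open import Relation.Binary.PropositionalEquality using (_≡_)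

record Multigraph (n : ℕ) : Set where
  field
    mult      : Fin n → Fin n → ℕ
    symmetric : ∀ i j → mult i j ≡ mult j i

open Multigraph public

Loopless : ∀ {n} → Multigraph n → Set
Loopless G = ∀ i → mult G i i ≡ 0

data Reach {n : ℕ} (G : Multigraph n) : Fin n → Fin n → Set where
  here : ∀ {i} → Reach G i i
  step : ∀ {i j k} → 1 ≤ mult G i j → Reach G j k → Reach G i k

Connected : ∀ {n} → Multigraph n → Set
Connected G = ∀ i j → Reach G i j

sumFin : (n : ℕ) → (Fin n → ℕ) → ℕ
sumFin zero    f = 0
sumFin (suc n) f = f zero + sumFin n (λ i → f (suc i))

-- Σ over unordered pairs {i, j}, i ≠ j (encoded as toℕ i < toℕ j)
sumPairs : (n : ℕ) → (Fin n → Fin n → ℕ) → ℕ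
sumPairs n f = sumFin n (λ i → sumFin n (λ j →
  if toℕ i <ᵇ toℕ j then f i j else 0))

-- A cut A ⊆ V is given by its characteristic function.
-- Size of the cut: number of edges (with multiplicity) with exactly one endpoint in A.
cutSize : ∀ {n} → Multigraph n → (Fin n → Bool) → ℕ
cutSize {n} G A = sumPairs n (λ i j → if A i xor A j then mult G i j else 0)

allSubsets : (n : ℕ) → List (Fin n → Bool)
allSubsets zero    = (λ ()) ∷ []
allSubsets (suc n) = concatMap (λ A → ext false A ∷ ext true A ∷ []) (allSubsets n)
  where
  ext : Bool → (Fin n → Bool) → Fin (suc n) → Bool
  ext b A zero    = b
  ext b A (suc i) = A i

maxCut : ∀ {n} → Multigraph n → ℕ
maxCut {n} G = foldr _⊔_ 0 (map (cutSize G) (allSubsets n))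

multiEdgeTotal : ∀ {n} → Multigraph n → ℕ
multiEdgeTotal {n} G = sumPairs n (λ i j → if 2 ≤ᵇ mult G i j then mult G i j else 0)

{-# OPTIONS --safe #-}
-- Grow a vertex set S from the two ends of a multi-edge, each time adding a vertex w with a
-- neighbour in S and putting w on the side of a cut that receives at least half of w's edges
-- into S. This preserves (multiplicity of the multi-edges inside S) + 4|S| ≤ 4·(cut edges
-- inside S) + 2: w contributes at least one cut edge, and if it brings multi-edges of total
-- multiplicity m > 0 then it contributes at least max(2, m/2) cut edges. For S = V this gives
-- M + 4n ≤ 4μ(G) + 2 ≤ 4(n - 1 + ℓ) + 2, so M ≤ 4ℓ - 2 ≤ 2ℓ².
module Submission where

open import Defs
open import Data.Nat using (ℕ)

module MultiEdgeBound where

  open import Data.Bool using (Bool; true; false; if_then_else_; _xor_; not)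
  open import Data.Bool.Properties using (xor-comm; xor-same; ¬-not) renaming (_≟_ to _≟ᵇ_)
  open import Data.Fin using (Fin; zero; suc; toℕ)
  open import Data.Fin.Properties using (toℕ-injective; all?; ¬∀⟶∃¬)
  open import Data.List using (List; _∷_; map; foldr; concatMap)
  open import Data.List.Relation.Unary.Any as Any using (Any; here; there)
  open import Data.List.Relation.Unary.Any.Properties using (concatMap⁺)
  open import Data.Nat
  open import Data.Nat.Properties
  open import Algebra.Properties.Semiring.Sum +-*-semiring
    using (sum; sum-cong-≗; sum-replicate-zero; ∑-distrib-+; ∑-comm)
  open import Data.Nat.Tactic.RingSolver using (solve-∀)
  open import Data.Product using (∃; ∃₂; _×_; _,_; map₂)
  open import Data.Sum using (_⊎_; inj₁; inj₂)
  open import Data.Vec.Functional using (updateAt)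
  open import Data.Vec.Functional.Properties using (updateAt-updates; updateAt-minimal)
  open import Function using (_∘_; const)
  open import Relation.Binary.PropositionalEquality
  open import Relation.Nullary using (yes; no; contradiction)
  open import Relation.Nullary.Reflects using (ofʸ; ofⁿ)
  open ≤-Reasoning

  sumFin≡sum : ∀ n (f : Fin n → ℕ) → sumFin n f ≡ sum f
  sumFin≡sum zero    f = refl
  sumFin≡sum (suc n) f = cong (f zero +_) (sumFin≡sum n (f ∘ suc))

  sum-mono-≤ : ∀ {n} {f g : Fin n → ℕ} → (∀ i → f i ≤ g i) → sum f ≤ sum g
  sum-mono-≤ {zero}  f≤g = z≤n
  sum-mono-≤ {suc n} f≤g = +-mono-≤ (f≤g zero) (sum-mono-≤ (f≤g ∘ suc))

  ≤-sum : ∀ {n} (f : Fin n → ℕ) i → f i ≤ sum f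
  ≤-sum f zero    = m≤m+n (f zero) _
  ≤-sum f (suc i) = ≤-trans (≤-sum (f ∘ suc) i) (m≤n+m _ (f zero))

  sum-positive : ∀ {n} (f : Fin n → ℕ) → 0 < sum f → ∃ λ i → 0 < f i
  sum-positive {suc n} f pos with f zero in f₀
  ... | suc _ = zero , subst (0 <_) (sym f₀) z<s
  ... | zero  with sum-positive (f ∘ suc) pos
  ...   | i , p = suc i , p

  χ : Bool → ℕ
  χ b = if b then 1 else 0

  ∅ : ∀ {n} → Fin n → Bool
  ∅ _ = false

  insert : ∀ {n} → Fin n → (Fin n → Bool) → Fin n → Bool
  insert w S = updateAt S w (const true)

  sumOn : ∀ {n} → (Fin n → Bool) → (Fin n → ℕ) → ℕ
  sumOn S f = sum (λ i → χ (S i) * f i)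

  size : ∀ {n} → (Fin n → Bool) → ℕ
  size S = sumOn S (const 1)

  sumOn² : ∀ {n} → (Fin n → Bool) → (Fin n → Fin n → ℕ) → ℕ
  sumOn² S h = sumOn S (λ i → sumOn S (h i))

  member≢nonmember : ∀ {n} {S : Fin n → Bool} {i j} → S i ≡ true → S j ≡ false → i ≢ j
  member≢nonmember Si Sj refl = contradiction (trans (sym Si) Sj) λ ()

  insert-⊇ : ∀ {n} (S : Fin n → Bool) {i w} → S i ≡ true → S w ≡ false → insert w S i ≡ true
  insert-⊇ S {i} {w} Si Sw = trans (updateAt-minimal i w S (member≢nonmember Si Sw)) Si

  sumOn-cong : ∀ {n} (S : Fin n → Bool) {f g : Fin n → ℕ} →
    (∀ i → S i ≡ true → f i ≡ g i) → sumOn S f ≡ sumOn S g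
  sumOn-cong S {f} {g} f≈g = sum-cong-≗ agree
    where
    agree : ∀ i → χ (S i) * f i ≡ χ (S i) * g i
    agree i with S i in Si
    ... | true  = cong (1 *_) (f≈g i Si)
    ... | false = refl

  sumOn-+ : ∀ {n} (S : Fin n → Bool) (f g : Fin n → ℕ) →
    sumOn S (λ i → f i + g i) ≡ sumOn S f + sumOn S g
  sumOn-+ S f g = trans (sum-cong-≗ (λ i → *-distribˡ-+ (χ (S i)) (f i) (g i)))
                      (∑-distrib-+ (λ i → χ (S i) * f i) (λ i → χ (S i) * g i))

  sumOn-mono-≤ : ∀ {n} (S : Fin n → Bool) {f g : Fin n → ℕ} →
    (∀ i → f i ≤ g i) → sumOn S f ≤ sumOn S g
  sumOn-mono-≤ S f≤g = sum-mono-≤ (λ i → *-monoʳ-≤ (χ (S i)) (f≤g i))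

  ≤-sumOn : ∀ {n} (S : Fin n → Bool) (f : Fin n → ℕ) {i} → S i ≡ true → f i ≤ sumOn S f
  ≤-sumOn S f {i} Si = begin
    f i               ≡⟨ *-identityˡ (f i) ⟨
    1 * f i           ≡⟨ cong (λ b → χ b * f i) Si ⟨
    χ (S i) * f i     ≤⟨ ≤-sum _ i ⟩
    sumOn S f         ∎

  sumOn-positive : ∀ {n} (S : Fin n → Bool) (f : Fin n → ℕ) →
    0 < sumOn S f → ∃ λ i → S i ≡ true × 0 < f i
  sumOn-positive S f pos with sum-positive _ pos
  ... | i , p with S i in Si
  ...   | true  = i , Si , subst (0 <_) (*-identityˡ (f i)) p
  ...   | false = contradiction p (<-irrefl refl)

  sumOn-∅ : ∀ {n} (f : Fin n → ℕ) → sumOn ∅ f ≡ 0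
  sumOn-∅ {n} f = sum-replicate-zero n

  sumOn-full : ∀ {n} (S : Fin n → Bool) {f : Fin n → ℕ} → (∀ i → S i ≡ true) → sumOn S f ≡ sum f
  sumOn-full S {f} full =
    sum-cong-≗ (λ i → trans (cong (λ b → χ b * f i) (full i)) (*-identityˡ (f i)))

  sumOn-insert : ∀ {n} (S : Fin n → Bool) {w} (f : Fin n → ℕ) →
    S w ≡ false → sumOn (insert w S) f ≡ sumOn S f + f w
  sumOn-insert {suc n} S {zero} f Sw rewrite Sw =
    trans (cong (_+ sumOn (S ∘ suc) (f ∘ suc)) (*-identityˡ (f zero))) (+-comm (f zero) _)
  sumOn-insert {suc n} S {suc w} f Sw =
    trans (cong (χ (S zero) * f zero +_) (sumOn-insert (S ∘ suc) (f ∘ suc) Sw))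
          (sym (+-assoc (χ (S zero) * f zero) _ _))

  size-insert : ∀ {n} (S : Fin n → Bool) {w} → S w ≡ false → size (insert w S) ≡ size S + 1
  size-insert S = sumOn-insert S (const 1)

  size≤n : ∀ {n} (S : Fin n → Bool) → size S ≤ n
  size≤n {zero}  S = z≤n
  size≤n {suc n} S = +-mono-≤ (χ*1≤1 (S zero)) (size≤n (S ∘ suc))
    where
    χ*1≤1 : ∀ b → χ b * 1 ≤ 1
    χ*1≤1 true  = ≤-refl
    χ*1≤1 false = z≤n

  size-full : ∀ {n} (S : Fin n → Bool) → (∀ i → S i ≡ true) → size S ≡ n
  size-full {zero}  S full = refl
  size-full {suc n} S full = cong₂ (λ b k → χ b * 1 + k) (full zero) (size-full (S ∘ suc) (full ∘ suc))

  all-or-missing : ∀ {n} (S : Fin n → Bool) → (∀ i → S i ≡ true) ⊎ ∃ λ i → S i ≡ false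
  all-or-missing {n} S with all? (λ i → S i ≟ᵇ true)
  ... | yes full = inj₁ full
  ... | no ¬full = inj₂ (map₂ ¬-not (¬∀⟶∃¬ n (λ i → S i ≡ true) (λ i → S i ≟ᵇ true) ¬full))

  sumOn²-full : ∀ {n} (S : Fin n → Bool) {h : Fin n → Fin n → ℕ} →
    (∀ i → S i ≡ true) → sumOn² S h ≡ sum (λ i → sum (h i))
  sumOn²-full S {h} full =
    trans (sumOn-full S full) (sum-cong-≗ (λ i → sumOn-full S {h i} full))

  sumOn²-insert : ∀ {n} (S : Fin n → Bool) {w} {h : Fin n → Fin n → ℕ} →
    (∀ i j → h i j ≡ h j i) → h w w ≡ 0 → S w ≡ false →
    sumOn² (insert w S) h ≡ sumOn² S h + 2 * sumOn S (h w)
  sumOn²-insert S {w} {h} h-sym hww Sw = begin-equality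
    sumOn S′ (λ i → sumOn S′ (h i))
      ≡⟨ sumOn-cong S′ (λ i _ → sumOn-insert S (h i) Sw) ⟩
    sumOn S′ (λ i → sumOn S (h i) + h i w)
      ≡⟨ sumOn-+ S′ _ _ ⟩
    sumOn S′ (λ i → sumOn S (h i)) + sumOn S′ (λ i → h i w)
      ≡⟨ cong₂ _+_ (sumOn-insert S (λ i → sumOn S (h i)) Sw)
                   (sumOn-insert S (λ i → h i w) Sw) ⟩
    (sumOn² S h + sumOn S (h w)) + (sumOn S (λ i → h i w) + h w w)
      ≡⟨ cong₂ (λ x y → (sumOn² S h + sumOn S (h w)) + (x + y))
               (sumOn-cong S (λ i _ → h-sym i w)) hww ⟩
    (sumOn² S h + sumOn S (h w)) + (sumOn S (h w) + 0)
      ≡⟨ regroup (sumOn² S h) (sumOn S (h w)) ⟩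
    sumOn² S h + 2 * sumOn S (h w)
      ∎
    where
    S′ = insert w S
    regroup : ∀ a r → (a + r) + (r + 0) ≡ a + 2 * r
    regroup = solve-∀

  sumOn²-pair : ∀ {n} {a b} {h : Fin n → Fin n → ℕ} →
    (∀ i j → h i j ≡ h j i) → (∀ i → h i i ≡ 0) → insert a ∅ b ≡ false →
    sumOn² (insert b (insert a ∅)) h ≡ 2 * h b a
  sumOn²-pair {a = a} {b} {h} h-sym h-diag b∉ = begin-equality
    sumOn² (insert b S₁) h
      ≡⟨ sumOn²-insert S₁ h-sym (h-diag b) b∉ ⟩
    sumOn² S₁ h + 2 * sumOn S₁ (h b)
      ≡⟨ cong₂ (λ x y → x + 2 * y) sumOn²-S₁ (sumOn-insert ∅ (h b) refl) ⟩
    2 * (sumOn ∅ (h b) + h b a)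
      ≡⟨ cong (λ x → 2 * (x + h b a)) (sumOn-∅ (h b)) ⟩
    2 * h b a
      ∎
    where
    S₁ = insert a ∅
    sumOn²-S₁ : sumOn² S₁ h ≡ 0
    sumOn²-S₁ = trans (sumOn²-insert ∅ h-sym (h-diag a) refl)
                      (cong₂ (λ x y → x + 2 * y) (sumOn-∅ (λ i → sumOn ∅ (h i))) (sumOn-∅ (h a)))

  below : ∀ {n} → (Fin n → Fin n → ℕ) → Fin n → Fin n → ℕ
  below h i j = if toℕ i <ᵇ toℕ j then h i j else 0

  sumPairs≡sum : ∀ n (h : Fin n → Fin n → ℕ) → sumPairs n h ≡ sum (λ i → sum (below h i))
  sumPairs≡sum n h = trans (sumFin≡sum n _) (sum-cong-≗ (λ i → sumFin≡sum n (below h i)))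

  sumPairs-cong : ∀ n {h h′ : Fin n → Fin n → ℕ} →
    (∀ i j → h i j ≡ h′ i j) → sumPairs n h ≡ sumPairs n h′
  sumPairs-cong n {h} {h′} h≈h′ = begin-equality
    sumPairs n h                    ≡⟨ sumPairs≡sum n h ⟩
    sum (λ i → sum (below h i))     ≡⟨ sum-cong-≗ (λ i → sum-cong-≗ (λ j →
                                         cong (if toℕ i <ᵇ toℕ j then_else 0) (h≈h′ i j))) ⟩
    sum (λ i → sum (below h′ i))    ≡⟨ sumPairs≡sum n h′ ⟨
    sumPairs n h′                   ∎

  split-below : ∀ {n} {h : Fin n → Fin n → ℕ} →
    (∀ i j → h i j ≡ h j i) → (∀ i → h i i ≡ 0) →
    ∀ i j → h i j ≡ below h i j + below h j i
  split-below {h = h} h-sym h-diag i j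
    with toℕ i <ᵇ toℕ j | <ᵇ-reflects-< (toℕ i) (toℕ j)
       | toℕ j <ᵇ toℕ i | <ᵇ-reflects-< (toℕ j) (toℕ i)
  ... | true  | ofʸ i<j | true  | ofʸ j<i = contradiction j<i (<-asym i<j)
  ... | true  | _       | false | _       = sym (+-identityʳ (h i j))
  ... | false | _       | true  | _       = h-sym i j
  ... | false | ofⁿ i≮j | false | ofⁿ j≮i = trans (cong (h i) (sym i≡j)) (h-diag i)
    where
    i≡j : i ≡ j
    i≡j = toℕ-injective (≤-antisym (≮⇒≥ j≮i) (≮⇒≥ i≮j))

  sum²≡2*sumPairs : ∀ {n} {h : Fin n → Fin n → ℕ} →
    (∀ i j → h i j ≡ h j i) → (∀ i → h i i ≡ 0) →
    sum (λ i → sum (h i)) ≡ 2 * sumPairs n h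
  sum²≡2*sumPairs {n} {h} h-sym h-diag = begin-equality
    sum (λ i → sum (h i))
      ≡⟨ sum-cong-≗ (λ i → trans (sum-cong-≗ (split-below h-sym h-diag i))
                                 (∑-distrib-+ (below h i) (λ j → below h j i))) ⟩
    sum (λ i → sum (below h i) + sum (λ j → below h j i))
      ≡⟨ ∑-distrib-+ (λ i → sum (below h i)) (λ i → sum (λ j → below h j i)) ⟩
    P + sum (λ i → sum (λ j → below h j i))
      ≡⟨ cong (P +_) (∑-comm (λ i j → below h j i)) ⟩
    P + P
      ≡⟨ cong (P +_) (+-identityʳ P) ⟨
    2 * P
      ≡⟨ cong (2 *_) (sumPairs≡sum n h) ⟨
    2 * sumPairs n h
      ∎
    where
    P = sum (λ i → sum (below h i))

  across : Bool → Bool → ℕ → ℕ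
  across a b m = if a xor b then m else 0

  across-split : ∀ c m → m ≡ across true c m + across false c m
  across-split true  m = refl
  across-split false m = sym (+-identityʳ m)

  across-opposite : ∀ c m → across (not c) c m ≡ m
  across-opposite true  m = refl
  across-opposite false m = refl

  crossing : ∀ {n} → Multigraph n → (Fin n → Bool) → Fin n → Fin n → ℕ
  crossing G A i j = across (A i) (A j) (mult G i j)

  crossing-sym : ∀ {n} (G : Multigraph n) A i j → crossing G A i j ≡ crossing G A j i
  crossing-sym G A i j = cong₂ (if_then_else 0) (xor-comm (A i) (A j)) (symmetric G i j)

  crossing-diag : ∀ {n} (G : Multigraph n) A i → crossing G A i i ≡ 0
  crossing-diag G A i = cong (if_then mult G i i else 0) (xor-same (A i))

  crossing-cong : ∀ {n} (G : Multigraph n) {A B : Fin n → Bool} {i j} →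
    A i ≡ B i → A j ≡ B j → crossing G A i j ≡ crossing G B i j
  crossing-cong G {i = i} {j} Ai≡Bi Aj≡Bj = cong₂ (λ a b → across a b (mult G i j)) Ai≡Bi Aj≡Bj

  multiEdge : ∀ {n} → Multigraph n → Fin n → Fin n → ℕ
  multiEdge G i j = if 2 ≤ᵇ mult G i j then mult G i j else 0

  multiEdge-sym : ∀ {n} (G : Multigraph n) i j → multiEdge G i j ≡ multiEdge G j i
  multiEdge-sym G i j = cong (λ m → if 2 ≤ᵇ m then m else 0) (symmetric G i j)

  multiEdge-diag : ∀ {n} (G : Multigraph n) → Loopless G → ∀ i → multiEdge G i i ≡ 0
  multiEdge-diag G loopless i = cong (λ m → if 2 ≤ᵇ m then m else 0) (loopless i)

  multiEdge≤mult : ∀ {n} (G : Multigraph n) i j → multiEdge G i j ≤ mult G i j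
  multiEdge≤mult G i j with 2 ≤ᵇ mult G i j
  ... | true  = ≤-refl
  ... | false = z≤n

  multiEdge-positive : ∀ {n} (G : Multigraph n) {i j} → 0 < multiEdge G i j → 2 ≤ mult G i j
  multiEdge-positive G {i} {j} with 2 ≤ᵇ mult G i j | ≤ᵇ-reflects-≤ 2 (mult G i j)
  ... | true  | ofʸ 2≤m = const 2≤m
  ... | false | _       = λ ()

  multiEdge-heavy : ∀ {n} (G : Multigraph n) {i j} → 2 ≤ mult G i j → multiEdge G i j ≡ mult G i j
  multiEdge-heavy G {i} {j} 2≤m with 2 ≤ᵇ mult G i j | ≤ᵇ-reflects-≤ 2 (mult G i j)
  ... | true  | _       = refl
  ... | false | ofⁿ 2≰m = contradiction 2≤m 2≰m

  ≤-foldr-⊔ : ∀ {A : Set} {f : A → ℕ} {k xs} → Any (λ x → k ≤ f x) xs → k ≤ foldr _⊔_ 0 (map f xs)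
  ≤-foldr-⊔ (here k≤)  = ≤-trans k≤ (m≤m⊔n _ _)
  ≤-foldr-⊔ (there k≤) = ≤-trans (≤-foldr-⊔ k≤) (m≤n⊔m _ _)

  -- Stated for an arbitrary F since the extension function of allSubsets is local to it.
  extensions-complete : ∀ {n} {F : (Fin n → Bool) → List (Fin (suc n) → Bool)} {xs} →
    (∀ b B → Any (λ C → C zero ≡ b × (∀ i → C (suc i) ≡ B i)) (F B)) →
    (∀ B → Any (B ≗_) xs) → ∀ A → Any (A ≗_) (concatMap F xs)
  extensions-complete {F = F} extensions complete A =
    concatMap⁺ F (Any.map extension (complete (A ∘ suc)))
    where
    extension : ∀ {B} → A ∘ suc ≗ B → Any (A ≗_) (F B)
    extension {B} tail≗B = Any.map glue (extensions (A zero) B)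
      where
      glue : ∀ {C} → C zero ≡ A zero × (∀ i → C (suc i) ≡ B i) → A ≗ C
      glue (C₀ , Cₛ) zero    = sym C₀
      glue (C₀ , Cₛ) (suc i) = trans (tail≗B i) (sym (Cₛ i))

  allSubsets-complete : ∀ n (A : Fin n → Bool) → Any (A ≗_) (allSubsets n)
  allSubsets-complete zero    A = here (λ ())
  allSubsets-complete (suc n) = extensions-complete
    (λ { false B → here (refl , λ _ → refl) ; true B → there (here (refl , λ _ → refl)) })
    (allSubsets-complete n)

  cutSize≤maxCut : ∀ {n} (G : Multigraph n) A → cutSize G A ≤ maxCut G
  cutSize≤maxCut {n} G A = ≤-foldr-⊔ (Any.map cut≤ (allSubsets-complete n A))
    where
    cut≤ : ∀ {B} → A ≗ B → cutSize G A ≤ cutSize G B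
    cut≤ A≗B = ≤-reflexive (sumPairs-cong n (λ i j → crossing-cong G (A≗B i) (A≗B j)))

  -- Twice the invariant of the header: sumOn² counts every pair inside S in both orders.
  GoodCut : ∀ {n} → Multigraph n → (Fin n → Bool) → (Fin n → Bool) → Set
  GoodCut G S A = sumOn² S (multiEdge G) + 8 * size S ≤ 4 * sumOn² S (crossing G A) + 4

  maximising-side : (f : Bool → ℕ) → ∃ λ b → ∀ c → f c ≤ f b
  maximising-side f with f false ≤? f true
  ... | yes f≤t = true  , λ { false → f≤t ; true → ≤-refl }
  ... | no  f≰t = false , λ { false → ≤-refl ; true → ≰⇒≥ f≰t }

  sideWeight : ∀ {n} → (S A : Fin n → Bool) → (Fin n → ℕ) → Bool → ℕ
  sideWeight S A row b = sumOn S (λ j → across b (A j) (row j))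

  majority-side : ∀ {n} (S A : Fin n → Bool) (row : Fin n → ℕ) → ∃ λ b →
    sumOn S row ≤ 2 * sideWeight S A row b × (∀ j → S j ≡ true → row j ≤ sideWeight S A row b)
  majority-side S A row with maximising-side (sideWeight S A row)
  ... | b , maximal = b , half , single
    where
    side = sideWeight S A row
    half : sumOn S row ≤ 2 * side b
    half = begin
      sumOn S row                ≡⟨ sumOn-cong S (λ j _ → across-split (A j) (row j)) ⟩
      sumOn S (λ j → across true (A j) (row j) + across false (A j) (row j))
                                 ≡⟨ sumOn-+ S _ _ ⟩
      side true + side false     ≤⟨ +-mono-≤ (maximal true) (maximal false) ⟩
      side b + side b            ≡⟨ cong (side b +_) (+-identityʳ (side b)) ⟨
      2 * side b                 ∎
    single : ∀ j → S j ≡ true → row j ≤ side b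
    single j Sj = begin
      row j                             ≡⟨ across-opposite (A j) (row j) ⟨
      across (not (A j)) (A j) (row j)  ≤⟨ ≤-sumOn S (λ k → across (not (A j)) (A k) (row k)) Sj ⟩
      side (not (A j))                  ≤⟨ maximal (not (A j)) ⟩
      side b                            ∎

  sumOn²-crossing-insert : ∀ {n} (G : Multigraph n) {S A : Fin n → Bool} {w} b →
    S w ≡ false →
    sumOn² (insert w S) (crossing G (updateAt A w (const b)))
      ≡ sumOn² S (crossing G A) + 2 * sideWeight S A (mult G w) b
  sumOn²-crossing-insert G {S} {A} {w} b Sw = begin-equality
    sumOn² (insert w S) (crossing G A′)
      ≡⟨ sumOn²-insert S (crossing-sym G A′) (crossing-diag G A′ w) Sw ⟩
    sumOn² S (crossing G A′) + 2 * sumOn S (crossing G A′ w)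
      ≡⟨ cong₂ (λ x y → x + 2 * y)
           (sumOn-cong S (λ i Si → sumOn-cong S (λ j Sj → crossing-cong G (A′≡A Si) (A′≡A Sj))))
           (sumOn-cong S (λ j Sj →
             cong₂ (λ x y → across x y (mult G w j)) (updateAt-updates w A) (A′≡A Sj))) ⟩
    sumOn² S (crossing G A) + 2 * sideWeight S A (mult G w) b
      ∎
    where
    A′ = updateAt A w (const b)
    A′≡A : ∀ {i} → S i ≡ true → A′ i ≡ A i
    A′≡A {i} Si = updateAt-minimal i w A (member≢nonmember Si Sw)

  step-arith : ∀ {d r m} → d ≤ 2 * r → 0 < d → m ≤ d → m ≡ 0 ⊎ 2 ≤ r → m + 4 ≤ 4 * r
  step-arith {r = zero}  d≤0 0<d _   _            = contradiction (≤-trans 0<d d≤0) λ ()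
  step-arith {r = suc r} _   _   _   (inj₁ refl)  = *-monoʳ-≤ 4 (s≤s z≤n)
  step-arith {d} {r} {m} d≤2r _ m≤d (inj₂ 2≤r) = begin
    m + 4          ≤⟨ +-mono-≤ (≤-trans m≤d d≤2r) (*-monoʳ-≤ 2 2≤r) ⟩
    2 * r + 2 * r  ≡⟨ double-double r ⟩
    4 * r          ∎
    where
    double-double : ∀ r → 2 * r + 2 * r ≡ 4 * r
    double-double = solve-∀

  goodCut-insert-arith : ∀ {W C s m r} → W + 8 * s ≤ 4 * C + 4 → m + 4 ≤ 4 * r →
    (W + 2 * m) + 8 * (s + 1) ≤ 4 * (C + 2 * r) + 4
  goodCut-insert-arith {W} {C} {s} {m} {r} good new = begin
    (W + 2 * m) + 8 * (s + 1)  ≡⟨ regroupˡ W s m ⟩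
    (W + 8 * s) + 2 * (m + 4)  ≤⟨ +-mono-≤ good (*-monoʳ-≤ 2 new) ⟩
    (4 * C + 4) + 2 * (4 * r)  ≡⟨ regroupʳ C r ⟩
    4 * (C + 2 * r) + 4        ∎
    where
    regroupˡ : ∀ W s m → (W + 2 * m) + 8 * (s + 1) ≡ (W + 8 * s) + 2 * (m + 4)
    regroupˡ = solve-∀
    regroupʳ : ∀ C r → (4 * C + 4) + 2 * (4 * r) ≡ 4 * (C + 2 * r) + 4
    regroupʳ = solve-∀

  goodCut-pair-arith : ∀ {M} → 2 ≤ M → 2 * M + 8 * 2 ≤ 4 * (2 * M) + 4
  goodCut-pair-arith {M} 2≤M = begin
    2 * M + (6 * 2 + 4)  ≤⟨ +-monoʳ-≤ (2 * M) (+-monoˡ-≤ 4 (*-monoʳ-≤ 6 2≤M)) ⟩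
    2 * M + (6 * M + 4)  ≡⟨ regroup M ⟩
    4 * (2 * M) + 4      ∎
    where
    regroup : ∀ M → 2 * M + (6 * M + 4) ≡ 4 * (2 * M) + 4
    regroup = solve-∀

  frontier : ∀ {n} {G : Multigraph n} (S : Fin n → Bool) {i k} → Reach G i k →
    S i ≡ true → S k ≡ false → ∃₂ λ s w → S s ≡ true × S w ≡ false × 0 < mult G s w
  frontier S here               Si Sk = contradiction (trans (sym Si) Sk) λ ()
  frontier S (step {j = j} e r) Si Sk with S j in Sj
  ... | true  = frontier S r Sj Sk
  ... | false = _ , _ , Si , Sj , e

  module _ {n} (G : Multigraph n) (loopless : Loopless G) where

    goodCut-insert : ∀ {S A s w} → S s ≡ true → S w ≡ false → 0 < mult G s w →
      GoodCut G S A → ∃ (GoodCut G (insert w S))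
    goodCut-insert {S} {A} {s} {w} Ss Sw s~w good with majority-side S A (mult G w)
    ... | b , d≤2r , edge≤r = updateAt A w (const b) , (begin
      sumOn² (insert w S) (multiEdge G) + 8 * size (insert w S)
        ≡⟨ cong₂ (λ x y → x + 8 * y)
             (sumOn²-insert S (multiEdge-sym G) (multiEdge-diag G loopless w) Sw)
             (size-insert S Sw) ⟩
      (sumOn² S (multiEdge G) + 2 * m) + 8 * (size S + 1)
        ≤⟨ goodCut-insert-arith {sumOn² S (multiEdge G)} {sumOn² S (crossing G A)} {size S} {m} {r}
             good (step-arith {d} {r} {m} d≤2r 0<d m≤d m≡0⊎2≤r) ⟩
      4 * (sumOn² S (crossing G A) + 2 * r) + 4
        ≡⟨ cong (λ x → 4 * x + 4) (sumOn²-crossing-insert G b Sw) ⟨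
      4 * sumOn² (insert w S) (crossing G (updateAt A w (const b))) + 4
        ∎)
      where
      d = sumOn S (mult G w)
      r = sideWeight S A (mult G w) b
      m = sumOn S (multiEdge G w)
      0<d : 0 < d
      0<d = ≤-trans (subst (0 <_) (symmetric G s w) s~w) (≤-sumOn S (mult G w) Ss)
      m≤d : m ≤ d
      m≤d = sumOn-mono-≤ S (multiEdge≤mult G w)
      m≡0⊎2≤r : m ≡ 0 ⊎ 2 ≤ r
      m≡0⊎2≤r with m ≟ 0
      ... | yes m≡0 = inj₁ m≡0
      ... | no  m≢0 with sumOn-positive S (multiEdge G w) (n≢0⇒n>0 m≢0)
      ...   | j , Sj , heavy = inj₂ (≤-trans (multiEdge-positive G heavy) (edge≤r j Sj))

    goodCut-pair : ∀ {a b} → 2 ≤ mult G a b → GoodCut G (insert b (insert a ∅)) (insert a ∅)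
    goodCut-pair {a} {b} 2≤ab = begin
      sumOn² S (multiEdge G) + 8 * size S
        ≡⟨ cong₂ (λ x y → x + 8 * y)
             (trans (sumOn²-pair {a = a} {b} (multiEdge-sym G) (multiEdge-diag G loopless) b∉)
                    (cong (2 *_) (multiEdge-heavy G 2≤ba)))
             size≡2 ⟩
      2 * M + 8 * 2
        ≤⟨ goodCut-pair-arith 2≤ba ⟩
      4 * (2 * M) + 4
        ≡⟨ cong (λ x → 4 * (2 * x) + 4) crossing-ba ⟨
      4 * (2 * crossing G (insert a ∅) b a) + 4
        ≡⟨ cong (λ x → 4 * x + 4)
             (sumOn²-pair {a = a} {b} (crossing-sym G (insert a ∅)) (crossing-diag G (insert a ∅)) b∉) ⟨
      4 * sumOn² S (crossing G (insert a ∅)) + 4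
        ∎
      where
      S = insert b (insert a ∅)
      M = mult G b a
      2≤ba : 2 ≤ M
      2≤ba = subst (2 ≤_) (symmetric G a b) 2≤ab
      b≢a : b ≢ a
      b≢a refl = contradiction (subst (2 ≤_) (loopless a) 2≤ab) λ ()
      b∉ : insert a ∅ b ≡ false
      b∉ = updateAt-minimal b a ∅ b≢a
      crossing-ba : crossing G (insert a ∅) b a ≡ M
      crossing-ba = cong₂ (λ x y → across x y M) b∉ (updateAt-updates a ∅)
      size≡2 : size S ≡ 2
      size≡2 = trans (size-insert (insert a ∅) b∉)
                     (cong (_+ 1) (trans (size-insert ∅ {a} refl) (cong (_+ 1) (sumOn-∅ {n} (const 1)))))

    goodCut-grow : Connected G → ∀ k {S A s} → n ≤ size S + k → S s ≡ true → GoodCut G S A →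
      ∃₂ λ S A → (∀ i → S i ≡ true) × GoodCut G S A
    goodCut-grow connected zero {S} {A} n≤ Ss good with all-or-missing S
    ... | inj₁ full     = S , A , full , good
    ... | inj₂ (j , Sj) = contradiction (+-cancelˡ-≤ (size S) 1 0 S+1≤S) λ ()
      where
      S+1≤S : size S + 1 ≤ size S + 0
      S+1≤S = ≤-trans (subst (_≤ n) (size-insert S Sj) (size≤n (insert j S))) n≤
    goodCut-grow connected (suc k) {S} {A} {s} n≤ Ss good with all-or-missing S
    ... | inj₁ full     = S , A , full , good
    ... | inj₂ (j , Sj) with frontier S (connected s j) Ss Sj
    ...   | t , w , St , Sw , t~w =
      let A′ , good′ = goodCut-insert {S} {A} {t} {w} St Sw t~w good
      in goodCut-grow connected k {insert w S} {A′} {s} n≤′ (insert-⊇ S Ss Sw) good′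
      where
      n≤′ : n ≤ size (insert w S) + k
      n≤′ = subst (n ≤_) (trans (sym (+-assoc (size S) 1 k)) (cong (_+ k) (sym (size-insert S Sw))))
                  n≤

    goodCut-spanning : ∀ {S A} → (∀ i → S i ≡ true) → GoodCut G S A →
      multiEdgeTotal G + 4 * n ≤ 4 * cutSize G A + 2
    goodCut-spanning {S} {A} full good = *-cancelˡ-≤ 2 (begin
      2 * (multiEdgeTotal G + 4 * n)
        ≡⟨ regroupˡ (multiEdgeTotal G) n ⟩
      2 * multiEdgeTotal G + 8 * n
        ≡⟨ cong₂ (λ x y → x + 8 * y)
             (spanning (multiEdge-sym G) (multiEdge-diag G loopless)) (size-full S full) ⟨
      sumOn² S (multiEdge G) + 8 * size S
        ≤⟨ good ⟩
      4 * sumOn² S (crossing G A) + 4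
        ≡⟨ cong (λ x → 4 * x + 4) (spanning (crossing-sym G A) (crossing-diag G A)) ⟩
      4 * (2 * cutSize G A) + 4
        ≡⟨ regroupʳ (cutSize G A) ⟩
      2 * (4 * cutSize G A + 2)
        ∎)
      where
      spanning : ∀ {h} → (∀ i j → h i j ≡ h j i) → (∀ i → h i i ≡ 0) →
        sumOn² S h ≡ 2 * sumPairs n h
      spanning {h} h-sym h-diag = trans (sumOn²-full S {h} full) (sum²≡2*sumPairs h-sym h-diag)
      regroupˡ : ∀ T n → 2 * (T + 4 * n) ≡ 2 * T + 8 * n
      regroupˡ = solve-∀
      regroupʳ : ∀ c → 4 * (2 * c) + 4 ≡ 2 * (4 * c + 2)
      regroupʳ = solve-∀

    no-multiEdge⊎multiEdge : multiEdgeTotal G ≡ 0 ⊎ ∃₂ λ a b → 2 ≤ mult G a b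
    no-multiEdge⊎multiEdge with multiEdgeTotal G ≟ 0
    ... | yes T≡0 = inj₁ T≡0
    ... | no  T≢0 =
      let a , 0<a  = sum-positive _ 0<sum²
          b , 0<ab = sum-positive _ 0<a
      in inj₂ (a , b , multiEdge-positive G 0<ab)
      where
      0<sum² : 0 < sum (λ i → sum (multiEdge G i))
      0<sum² = subst (0 <_) (sym (sum²≡2*sumPairs (multiEdge-sym G) (multiEdge-diag G loopless)))
                     (≤-trans (n≢0⇒n>0 T≢0) (m≤m+n _ _))

    multiEdgeTotal-bound : Connected G →
      multiEdgeTotal G ≡ 0 ⊎ multiEdgeTotal G + 4 * n ≤ 4 * maxCut G + 2
    multiEdgeTotal-bound connected with no-multiEdge⊎multiEdge
    ... | inj₁ T≡0 = inj₁ T≡0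
    ... | inj₂ (a , b , 2≤ab) =
      let S , A , full , good = goodCut-grow connected n {insert b (insert a ∅)} {insert a ∅}
                                  (m≤n+m n _) (updateAt-updates b (insert a ∅)) (goodCut-pair 2≤ab)
      in inj₂ (begin
        multiEdgeTotal G + 4 * n  ≤⟨ goodCut-spanning {S} {A} full good ⟩
        4 * cutSize G A + 2       ≤⟨ +-monoˡ-≤ 2 (*-monoʳ-≤ 4 (cutSize≤maxCut G A)) ⟩
        4 * maxCut G + 2          ∎)

open MultiEdgeBound using (multiEdgeTotal-bound)
import Data.Nat as ℕ
open import Data.Nat using (z≤n)
open import Data.Integer using (ℤ; +_; _+_; _-_; _*_; _≤_; -_; -[1+_]; +≤+; nonNegative)
open import Data.Integer.Properties
  using (pos-+; pos-*; +-monoˡ-≤; *-monoˡ-≤-nonNeg; i≤i+j; module ≤-Reasoning)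
open import Data.Integer.Tactic.RingSolver using (solve-∀)
open import Data.Sum using (inj₁; inj₂)
open import Relation.Binary.PropositionalEquality using (_≡_; sym; trans; cong; subst; subst₂)

0≤2*square : ∀ i → + 0 ≤ + 2 * (i * i)
0≤2*square i = *-monoˡ-≤-nonNeg (+ 2) (0≤square i)
  where
  0≤square : ∀ i → + 0 ≤ i * i
  0≤square (+ n)    = subst (+ 0 ≤_) (pos-* n n) (+≤+ z≤n)
  0≤square -[1+ n ] = +≤+ z≤n

square-bound : ∀ (ℓ : ℤ) (T n μ : ℕ) → T ℕ.+ 4 ℕ.* n ℕ.≤ 4 ℕ.* μ ℕ.+ 2 →
  + μ ≤ (+ n - + 1) + ℓ → + T ≤ + 2 * (ℓ * ℓ)
square-bound ℓ T n μ cut-bound μ-bound = begin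
  + T
    ≡⟨ cancel (+ T) (+ 4 * + n) ⟨
  (+ T + + 4 * + n) - + 4 * + n
    ≤⟨ +-monoˡ-≤ (- (+ 4 * + n)) cut-boundℤ ⟩
  (+ 4 * + μ + + 2) - + 4 * + n
    ≤⟨ +-monoˡ-≤ (- (+ 4 * + n)) (+-monoˡ-≤ (+ 2) (*-monoˡ-≤-nonNeg (+ 4) μ-bound)) ⟩
  (+ 4 * ((+ n - + 1) + ℓ) + + 2) - + 4 * + n
    ≡⟨ simplify ℓ (+ n) ⟩
  + 4 * ℓ - + 2
    ≤⟨ i≤i+j _ _ {{nonNegative (0≤2*square (ℓ - + 1))}} ⟩
  (+ 4 * ℓ - + 2) + + 2 * ((ℓ - + 1) * (ℓ - + 1))
    ≡⟨ complete-square ℓ ⟩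
  + 2 * (ℓ * ℓ)
    ∎
  where
  open ≤-Reasoning
  cut-boundℤ : + T + + 4 * + n ≤ + 4 * + μ + + 2
  cut-boundℤ = subst₂ _≤_ (trans (pos-+ T _) (cong (λ x → + T + x) (pos-* 4 n)))
                          (trans (pos-+ _ 2) (cong (λ x → x + + 2) (pos-* 4 μ)))
                          (+≤+ cut-bound)
  cancel : ∀ x y → (x + y) - y ≡ x
  cancel = solve-∀
  simplify : ∀ ℓ n → (+ 4 * ((n - + 1) + ℓ) + + 2) - + 4 * n ≡ + 4 * ℓ - + 2
  simplify = solve-∀
  complete-square : ∀ ℓ → (+ 4 * ℓ - + 2) + + 2 * ((ℓ - + 1) * (ℓ - + 1)) ≡ + 2 * (ℓ * ℓ)
  complete-square = solve-∀

lemma27 : (ℓ : ℤ) (n : ℕ) (G : Multigraph n) →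
    Loopless G → Connected G →
    + maxCut G ≤ (+ n - + 1) + ℓ →
    + multiEdgeTotal G ≤ + 2 * (ℓ * ℓ)
lemma27 ℓ n G loopless connected μ-bound with multiEdgeTotal-bound G loopless connected
... | inj₁ T≡0      = subst (λ t → + t ≤ + 2 * (ℓ * ℓ)) (sym T≡0) (0≤2*square ℓ)
... | inj₂ cut-bound = square-bound ℓ (multiEdgeTotal G) n (maxCut G) cut-bound μ-bound
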